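{- Let $G$ be a graph with vertex set $V$, let $\pi$ be a permutation of $V$, and let $C_1, C_2$ be two distinct cycles of $\pi$ (viewed as subsets of $V$). If $C_1$ and $C_2$ are mutually routable in 2 steps, then $|C_1| = |C_2|$.
   Context: Routing via matchings: each vertex $v$ of a graph $G$ initially holds a pebble, and the permutation $\pi$ of $V$ prescribes that the pebble initially at $v$ must end at vertex $\pi(v)$. A step consists of choosing a matching of $G$ and swapping the pebbles at the two endpoints of every matched edge. A pair of cycles $C_1, C_2$ of $\pi$ is mutually routable in 2 steps if all pebbles initially on $C_1 \cup C_2$ can be brought to their destinations in at most 2 steps using only the edges of $G$ between the two subsets $C_1$ and $C_2$ (i.e. edges with one endpoint in $C_1$ and the other in $C_2$). -}

module Defs where

open import Data.Nat using (ℕ; zero; suc)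
open import Data.Fin using (Fin)
open import Data.Fin.Subset using (Subset; _∈_)
open import Data.Fin.Permutation using (Permutation′; _⟨$⟩ʳ_)
open import Data.Product using (Σ; ∃; _×_; _,_)
open import Data.Sum using (_⊎_)
open import Relation.Nullary using (¬_)
open import Relation.Binary.PropositionalEquality using (_≡_; _≢_)
open import Level using (0ℓ; suc)

record Graph (n : ℕ) : Set₁ where
  field
    Adj    : Fin n → Fin n → Set
    sym    : ∀ {u v} → Adj u v → Adj v u
    irrefl : ∀ {v} → ¬ Adj v v

open Graph public

iter : ∀ {n} → Permutation′ n → ℕ → Fin n → Fin n
iter π zero    v = v
iter π (suc k) v = π ⟨$⟩ʳ (iter π k v)

IsCycle : ∀ {n} → Permutation′ n → Subset n → Set
IsCycle {n} π C = Σ (Fin n) λ v → ∀ w → (w ∈ C → ∃ λ k → iter π k v ≡ w)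
                                        × ((∃ λ k → iter π k v ≡ w) → w ∈ C)

-- A matching of G using only edges between C₁ and C₂, encoded as an involution m
-- on V: m v = v means v is unmatched, otherwise v is matched to m v
-- (and {v, m v} is an edge of G with one endpoint in C₁ and the other in C₂).
-- One step moves the pebble at v to m v.
IsMatchingBetween : ∀ {n} → Graph n → Subset n → Subset n → (Fin n → Fin n) → Set
IsMatchingBetween {n} G C₁ C₂ m =
  (∀ v → m (m v) ≡ v) ×
  (∀ v → m v ≢ v → Adj G v (m v) × ((v ∈ C₁ × m v ∈ C₂) ⊎ (v ∈ C₂ × m v ∈ C₁)))

-- C₁, C₂ mutually routable in 2 steps: two matchings (possibly empty, so
-- "at most 2 steps" is covered) between C₁ and C₂ such that every pebble
-- starting on C₁ ∪ C₂ ends at its destination π v.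
MutuallyRoutable2 : ∀ {n} → Graph n → Permutation′ n → Subset n → Subset n → Set
MutuallyRoutable2 {n} G π C₁ C₂ =
  Σ (Fin n → Fin n) λ m₁ → Σ (Fin n → Fin n) λ m₂ →
    IsMatchingBetween G C₁ C₂ m₁ × IsMatchingBetween G C₁ C₂ m₂ ×
    (∀ v → (v ∈ C₁ ⊎ v ∈ C₂) → m₂ (m₁ v) ≡ π ⟨$⟩ʳ v)

-- A vertex of C₁ ∪ C₂ left alone by the first matching is fixed by π, since the second
-- matching cannot return a pebble to the cycle it started on; its cycle is then a
-- singleton, and the same is forced on the other cycle. Otherwise the first matching
-- moves every vertex of C₁ ∪ C₂ across, so, being an involution, it is a bijection
-- between C₁ and C₂.
module Submission where

open import Defs hiding (sym)
open import Data.Nat using (ℕ; zero; suc; _+_)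
open import Data.Nat.Properties using (+-0-commutativeMonoid; +-suc; +-comm; ≤-refl; m≤n⇒∃[o]m+o≡n)
open import Data.Bool using (true; false; if_then_else_)
open import Data.Fin using (Fin; toℕ; _≟_)
open import Data.Fin.Properties using (pigeonhole)
open import Data.Fin.Subset using (Subset; ∣_∣; _∈_; _∉_; ⁅_⁆)
open import Data.Fin.Subset.Properties using (⊆-antisym; x∈⁅x⁆; x∈⁅y⁆⇒x≡y; ∣⁅x⁆∣≡1)
open import Data.Fin.Permutation using (Permutation′; _⟨$⟩ʳ_; _⟨$⟩ˡ_; permutation; inverseˡ)
open import Data.Vec using ([]; _∷_; lookup)
open import Data.Vec.Properties using (lookup⇒[]=; []=⇒lookup)
open import Data.Product using (∃; _,_; proj₁; proj₂)
open import Data.Sum using (_⊎_; inj₁; inj₂; swap)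
open import Function using (_⇔_; mk⇔; Equivalence)
open import Relation.Nullary using (Dec; yes; no; contradiction)
open import Relation.Binary.PropositionalEquality
open import Algebra.Properties.CommutativeMonoid.Sum +-0-commutativeMonoid
  using (sum; sum-permute; sum-cong-≗)

open Equivalence using (to; from)

indicator : ∀ {n} → Subset n → Fin n → ℕ
indicator p i = if lookup p i then 1 else 0

∣p∣≡sum-indicator : ∀ {n} (p : Subset n) → ∣ p ∣ ≡ sum (indicator p)
∣p∣≡sum-indicator []          = refl
∣p∣≡sum-indicator (true ∷ p)  = cong suc (∣p∣≡sum-indicator p)
∣p∣≡sum-indicator (false ∷ p) = ∣p∣≡sum-indicator p

lookup-≡-if-∈⇔ : ∀ {n} {p q : Subset n} {i j} → i ∈ p ⇔ j ∈ q → lookup p i ≡ lookup q j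
lookup-≡-if-∈⇔ {_} {p} {q} {i} {j} i∈p⇔j∈q with lookup p i in eqᵢ | lookup q j in eqⱼ
... | true  | true  = refl
... | false | false = refl
... | true  | false = trans (sym ([]=⇒lookup (to i∈p⇔j∈q (lookup⇒[]= i p eqᵢ)))) eqⱼ
... | false | true  = trans (sym eqᵢ) ([]=⇒lookup (from i∈p⇔j∈q (lookup⇒[]= j q eqⱼ)))

∣∣-preserved-by-permutation : ∀ {n} {p q : Subset n} (σ : Permutation′ n) →
                              (∀ i → i ∈ p ⇔ σ ⟨$⟩ʳ i ∈ q) → ∣ p ∣ ≡ ∣ q ∣
∣∣-preserved-by-permutation {_} {p} {q} σ i∈p⇔σi∈q = begin
  ∣ p ∣                               ≡⟨ ∣p∣≡sum-indicator p ⟩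
  sum (indicator p)                   ≡⟨ sum-cong-≗ (λ i → cong (if_then 1 else 0)
                                                      (lookup-≡-if-∈⇔ (i∈p⇔σi∈q i))) ⟩
  sum (λ i → indicator q (σ ⟨$⟩ʳ i))  ≡⟨ sum-permute (indicator q) σ ⟨
  sum (indicator q)                   ≡⟨ ∣p∣≡sum-indicator q ⟨
  ∣ q ∣                               ∎
  where open ≡-Reasoning

module Orbits {n : ℕ} (π : Permutation′ n) where

  Reaches : Fin n → Fin n → Set
  Reaches v w = ∃ λ k → iter π k v ≡ w

  iter-+ : ∀ a b v → iter π (a + b) v ≡ iter π a (iter π b v)
  iter-+ zero    b v = refl
  iter-+ (suc a) b v = cong (π ⟨$⟩ʳ_) (iter-+ a b v)

  iter-injective : ∀ k {v w} → iter π k v ≡ iter π k w → v ≡ w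
  iter-injective zero    eq = eq
  iter-injective (suc k) eq =
    iter-injective k (trans (sym (inverseˡ π)) (trans (cong (π ⟨$⟩ˡ_) eq) (inverseˡ π)))

  iter-fixed : ∀ {v} → π ⟨$⟩ʳ v ≡ v → ∀ k → iter π k v ≡ v
  iter-fixed πv≡v zero    = refl
  iter-fixed πv≡v (suc k) = trans (cong (π ⟨$⟩ʳ_) (iter-fixed πv≡v k)) πv≡v

  -- Pigeonhole on v, π v, …, πⁿ v; cancelling the common prefix leaves a return to v.
  iter-periodic : ∀ v → ∃ λ k → iter π (suc k) v ≡ v
  iter-periodic v with pigeonhole ≤-refl (λ (i : Fin (suc n)) → iter π (toℕ i) v)
  ... | i , j , i<j , πⁱv≡πʲv with m≤n⇒∃[o]m+o≡n i<j
  ... | k , i+1+k≡j = k , sym (iter-injective (toℕ i) (begin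
        iter π (toℕ i) v                   ≡⟨ πⁱv≡πʲv ⟩
        iter π (toℕ j) v                   ≡⟨ cong (λ m → iter π m v) (trans (sym i+1+k≡j) (sym (+-suc (toℕ i) k))) ⟩
        iter π (toℕ i + suc k) v           ≡⟨ iter-+ (toℕ i) (suc k) v ⟩
        iter π (toℕ i) (iter π (suc k) v)  ∎))
    where open ≡-Reasoning

  Reaches-refl : ∀ {v} → Reaches v v
  Reaches-refl = zero , refl

  Reaches-trans : ∀ {u v w} → Reaches u v → Reaches v w → Reaches u w
  Reaches-trans {u} (a , πᵃu≡v) (b , πᵇv≡w) = b + a , trans (iter-+ b a u) (trans (cong (iter π b) πᵃu≡v) πᵇv≡w)

  Reaches-step : ∀ {v w} → Reaches v w → Reaches v (π ⟨$⟩ʳ w)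
  Reaches-step (k , πᵏv≡w) = suc k , cong (π ⟨$⟩ʳ_) πᵏv≡w

  Reaches-back : ∀ v → Reaches (π ⟨$⟩ʳ v) v
  Reaches-back v with iter-periodic v
  ... | k , πᵏ⁺¹v≡v = k , (begin
    iter π k (π ⟨$⟩ʳ v)  ≡⟨ iter-+ k 1 v ⟨
    iter π (k + 1) v     ≡⟨ cong (λ m → iter π m v) (+-comm k 1) ⟩
    iter π (suc k) v     ≡⟨ πᵏ⁺¹v≡v ⟩
    v                    ∎)
    where open ≡-Reasoning

  Reaches-sym : ∀ {v w} → Reaches v w → Reaches w v
  Reaches-sym (zero  , refl) = Reaches-refl
  Reaches-sym (suc k , refl) = Reaches-trans (Reaches-back _) (Reaches-sym (k , refl))

  Reaches-fixed : ∀ {v w} → π ⟨$⟩ʳ v ≡ v → Reaches v w → w ≡ v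
  Reaches-fixed πv≡v (k , πᵏv≡w) = trans (sym πᵏv≡w) (iter-fixed πv≡v k)

  module Cycle {C : Subset n} (cycle : IsCycle π C) where

    root : Fin n
    root = proj₁ cycle

    ∈⇒Reaches : ∀ {w} → w ∈ C → Reaches root w
    ∈⇒Reaches {w} = proj₁ (proj₂ cycle w)

    Reaches⇒∈ : ∀ {w} → Reaches root w → w ∈ C
    Reaches⇒∈ {w} = proj₂ (proj₂ cycle w)

    root∈ : root ∈ C
    root∈ = Reaches⇒∈ Reaches-refl

    π-closed : ∀ {w} → w ∈ C → π ⟨$⟩ʳ w ∈ C
    π-closed w∈C = Reaches⇒∈ (Reaches-step (∈⇒Reaches w∈C))

    fixed⇒≡⁅⁆ : ∀ {v} → v ∈ C → π ⟨$⟩ʳ v ≡ v → C ≡ ⁅ v ⁆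
    fixed⇒≡⁅⁆ {v} v∈C πv≡v = ⊆-antisym C⊆⁅v⁆ (λ {w} w∈⁅v⁆ → subst (_∈ C) (sym (x∈⁅y⁆⇒x≡y v w∈⁅v⁆)) v∈C)
      where
      C⊆⁅v⁆ : ∀ {w} → w ∈ C → w ∈ ⁅ v ⁆
      C⊆⁅v⁆ w∈C = subst (_∈ ⁅ v ⁆) (sym (Reaches-fixed πv≡v
        (Reaches-trans (Reaches-sym (∈⇒Reaches v∈C)) (∈⇒Reaches w∈C)))) (x∈⁅x⁆ v)

  cycles-disjoint : ∀ {C D} → IsCycle π C → IsCycle π D → C ≢ D → ∀ {w} → w ∈ C → w ∉ D
  cycles-disjoint {C} {D} cycleC cycleD C≢D w∈C w∈D = C≢D (⊆-antisym (meet⇒⊆ cycleC cycleD w∈C w∈D)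
                                                                   (meet⇒⊆ cycleD cycleC w∈D w∈C))
    where
    meet⇒⊆ : ∀ {X Y} (cycleX : IsCycle π X) (cycleY : IsCycle π Y) →
             ∀ {w} → w ∈ X → w ∈ Y → ∀ {x} → x ∈ X → x ∈ Y
    meet⇒⊆ cycleX cycleY w∈X w∈Y x∈X = Y.Reaches⇒∈ (Reaches-trans (Reaches-trans (Y.∈⇒Reaches w∈Y)
                                          (Reaches-sym (X.∈⇒Reaches w∈X))) (X.∈⇒Reaches x∈X))
      where module X = Cycle cycleX
            module Y = Cycle cycleY

module Matchings {n : ℕ} (G : Graph n) where

  IsMatchingBetween-sym : ∀ {X Y m} → IsMatchingBetween G X Y m → IsMatchingBetween G Y X m
  IsMatchingBetween-sym (involutive , edges) =
    involutive , λ v mv≢v → proj₁ (edges v mv≢v) , swap (proj₂ (edges v mv≢v))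

  MutuallyRoutable2-sym : ∀ {π X Y} → MutuallyRoutable2 G π X Y → MutuallyRoutable2 G π Y X
  MutuallyRoutable2-sym (m₁ , m₂ , M₁ , M₂ , routes) =
    m₁ , m₂ , IsMatchingBetween-sym M₁ , IsMatchingBetween-sym M₂ , λ v v∈ → routes v (swap v∈)

  matching-crosses : ∀ {X Y m} → (∀ {w} → w ∈ X → w ∉ Y) → IsMatchingBetween G X Y m →
                     ∀ {v} → v ∈ X → m v ≢ v → m v ∈ Y
  matching-crosses disjoint (_ , edges) {v} v∈X mv≢v with proj₂ (edges v mv≢v)
  ... | inj₁ (_ , mv∈Y)   = mv∈Y
  ... | inj₂ (v∈Y , _)    = contradiction v∈Y (disjoint v∈X)

module Routing {n : ℕ} (G : Graph n) {π : Permutation′ n} {C₁ C₂ : Subset n}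
               (cycle₁ : IsCycle π C₁) (cycle₂ : IsCycle π C₂) (C₁≢C₂ : C₁ ≢ C₂)
               (routing : MutuallyRoutable2 G π C₁ C₂) where

  open Orbits π
  open Matchings G

  m₁ m₂ : Fin n → Fin n
  m₁ = proj₁ routing
  m₂ = proj₁ (proj₂ routing)

  private
    M₁ : IsMatchingBetween G C₁ C₂ m₁
    M₁ = proj₁ (proj₂ (proj₂ routing))
    M₂ : IsMatchingBetween G C₁ C₂ m₂
    M₂ = proj₁ (proj₂ (proj₂ (proj₂ routing)))
    routes : ∀ v → v ∈ C₁ ⊎ v ∈ C₂ → m₂ (m₁ v) ≡ π ⟨$⟩ʳ v
    routes = proj₂ (proj₂ (proj₂ (proj₂ routing)))
    module C₁ = Cycle cycle₁

  m₁-involutive : ∀ v → m₁ (m₁ v) ≡ v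
  m₁-involutive = proj₁ M₁

  disjoint₁₂ : ∀ {w} → w ∈ C₁ → w ∉ C₂
  disjoint₁₂ = cycles-disjoint cycle₁ cycle₂ C₁≢C₂

  disjoint₂₁ : ∀ {w} → w ∈ C₂ → w ∉ C₁
  disjoint₂₁ = cycles-disjoint cycle₂ cycle₁ (λ C₂≡C₁ → C₁≢C₂ (sym C₂≡C₁))

  m₁-crosses : ∀ {v} → v ∈ C₁ → m₁ v ≢ v → m₁ v ∈ C₂
  m₁-crosses = matching-crosses disjoint₁₂ M₁

  -- π v = m₂ v stays in the cycle of v, which the second matching may only leave.
  m₁-fixed⇒π-fixed : ∀ {v} → v ∈ C₁ → m₁ v ≡ v → π ⟨$⟩ʳ v ≡ v
  m₁-fixed⇒π-fixed {v} v∈C₁ m₁v≡v = by-cases (m₂ v ≟ v)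
    where
    m₂v≡πv : m₂ v ≡ π ⟨$⟩ʳ v
    m₂v≡πv = trans (cong m₂ (sym m₁v≡v)) (routes v (inj₁ v∈C₁))
    by-cases : Dec (m₂ v ≡ v) → π ⟨$⟩ʳ v ≡ v
    by-cases (yes m₂v≡v) = trans (sym m₂v≡πv) m₂v≡v
    by-cases (no  m₂v≢v) = contradiction (subst (_∈ C₂) m₂v≡πv (matching-crosses disjoint₁₂ M₂ v∈C₁ m₂v≢v))
                                         (disjoint₁₂ (C₁.π-closed v∈C₁))

  m₁-fixed⇒C₁≡⁅⁆ : ∀ {v} → v ∈ C₁ → m₁ v ≡ v → C₁ ≡ ⁅ v ⁆
  m₁-fixed⇒C₁≡⁅⁆ v∈C₁ m₁v≡v = C₁.fixed⇒≡⁅⁆ v∈C₁ (m₁-fixed⇒π-fixed v∈C₁ m₁v≡v)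

  m₁-fixed⇒∣C₁∣≡1 : ∀ {v} → v ∈ C₁ → m₁ v ≡ v → ∣ C₁ ∣ ≡ 1
  m₁-fixed⇒∣C₁∣≡1 {v} v∈C₁ m₁v≡v = trans (cong ∣_∣ (m₁-fixed⇒C₁≡⁅⁆ v∈C₁ m₁v≡v)) (∣⁅x⁆∣≡1 v)

  -- C₁ = {v}, so a crossing y ∈ C₂ would have m₁ y = v = m₁ v.
  m₁-fixed⇒m₁-fixes-C₂ : ∀ {v} → v ∈ C₁ → m₁ v ≡ v → ∀ {y} → y ∈ C₂ → m₁ y ≡ y
  m₁-fixed⇒m₁-fixes-C₂ {v} v∈C₁ m₁v≡v {y} y∈C₂ with m₁ y ≟ y
  ... | yes m₁y≡y = m₁y≡y
  ... | no  m₁y≢y = contradiction (subst (_∈ C₂) y≡v y∈C₂) (disjoint₁₂ v∈C₁)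
    where
    m₁y≡v : m₁ y ≡ v
    m₁y≡v = x∈⁅y⁆⇒x≡y v (subst (m₁ y ∈_) (m₁-fixed⇒C₁≡⁅⁆ v∈C₁ m₁v≡v)
                          (matching-crosses disjoint₂₁ (IsMatchingBetween-sym M₁) y∈C₂ m₁y≢y))
    y≡v : y ≡ v
    y≡v = trans (sym (m₁-involutive y)) (trans (cong m₁ m₁y≡v) m₁v≡v)

lemma1 : (n : ℕ) (G : Graph n) (π : Permutation′ n) (C₁ C₂ : Subset n) →
         IsCycle π C₁ → IsCycle π C₂ → C₁ ≢ C₂ →
         MutuallyRoutable2 G π C₁ C₂ → ∣ C₁ ∣ ≡ ∣ C₂ ∣
lemma1 n G π C₁ C₂ cycle₁ cycle₂ C₁≢C₂ routing = by-cases (m₁ x₀ ≟ x₀)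
  where
  open Matchings G using (MutuallyRoutable2-sym)
  module R₁₂ = Routing G cycle₁ cycle₂ C₁≢C₂ routing
  module R₂₁ = Routing G cycle₂ cycle₁ (λ C₂≡C₁ → C₁≢C₂ (sym C₂≡C₁)) (MutuallyRoutable2-sym {π} routing)
  open R₁₂ using (m₁)
  open Orbits.Cycle π cycle₁ using () renaming (root to x₀; root∈ to x₀∈C₁)
  open Orbits.Cycle π cycle₂ using () renaming (root to y₀; root∈ to y₀∈C₂)

  by-cases : Dec (m₁ x₀ ≡ x₀) → ∣ C₁ ∣ ≡ ∣ C₂ ∣
  by-cases (yes m₁x₀≡x₀) = trans (R₁₂.m₁-fixed⇒∣C₁∣≡1 x₀∈C₁ m₁x₀≡x₀)
    (sym (R₂₁.m₁-fixed⇒∣C₁∣≡1 y₀∈C₂ (R₁₂.m₁-fixed⇒m₁-fixes-C₂ x₀∈C₁ m₁x₀≡x₀ y₀∈C₂)))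
  by-cases (no m₁x₀≢x₀) = ∣∣-preserved-by-permutation
    (permutation m₁ m₁ R₁₂.m₁-involutive R₁₂.m₁-involutive)
    (λ i → mk⇔ (λ i∈C₁ → R₁₂.m₁-crosses i∈C₁ (moves₁ i∈C₁))
               (λ m₁i∈C₂ → subst (_∈ C₁) (R₁₂.m₁-involutive i) (R₂₁.m₁-crosses m₁i∈C₂ (moves₂ m₁i∈C₂))))
    where
    moves₂ : ∀ {y} → y ∈ C₂ → m₁ y ≢ y
    moves₂ y∈C₂ m₁y≡y = m₁x₀≢x₀ (R₂₁.m₁-fixed⇒m₁-fixes-C₂ y∈C₂ m₁y≡y x₀∈C₁)
    moves₁ : ∀ {x} → x ∈ C₁ → m₁ x ≢ x
    moves₁ x∈C₁ m₁x≡x = moves₂ y₀∈C₂ (R₁₂.m₁-fixed⇒m₁-fixes-C₂ x∈C₁ m₁x≡x y₀∈C₂)
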